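{- Let $s > r \ge 2$ be integers and let $G=(V,E)$ be an $n$-vertex strongly $K_s$-saturated graph whose number of copies of $K_r$ equals $\mathrm{ssat}(n,K_r,K_s)$. Let $E_1$ be the set of edges of $G$ contained in at least one copy of $K_r$ and $E_2 = E \setminus E_1$. Then for every edge $uv \in E_2$ and every non-edge $ab$ of $G$, the graph obtained from $G$ by adding $ab$ contains no copy of $K_s$ containing both $u$ and $v$.
   Context: A graph $G$ is strongly $K_s$-saturated if adding any edge to $G$ creates a new copy of $K_s$ ($G$ need not be $K_s$-free). $\mathrm{ssat}(n,K_r,K_s)$ is the minimum number of copies of $K_r$ in an $n$-vertex strongly $K_s$-saturated graph. -}

module Defs where

open import Data.Bool using (Bool; true; false; _∨_; _∧_)
open import Data.Nat using (ℕ; zero; suc)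
open import Data.Fin using (Fin; _≟_)
open import Data.Fin.Subset using (Subset; _∈_; ∣_∣)
open import Data.Vec using (Vec; []; _∷_)
open import Data.List using (List; []; _∷_; map; _++_; length; filter)
open import Data.Product using (Σ; ∃; _×_; _,_)
open import Relation.Nullary using (¬_; Dec; yes; no)
open import Relation.Nullary.Decidable using (⌊_⌋; _×-dec_)
open import Relation.Binary.PropositionalEquality using (_≡_; _≢_)
open import Data.Fin.Properties using (all?)
open import Data.Nat.Properties using () renaming (_≟_ to _≟ℕ_)
open import Data.Bool.Properties using () renaming (_≟_ to _≟B_)
open import Data.Fin.Subset.Properties using (_∈?_)

record Graph (n : ℕ) : Set where
  field
    adj    : Fin n → Fin n → Bool
    sym    : ∀ x y → adj x y ≡ adj y x
    irrefl : ∀ x → adj x x ≡ false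
open Graph public

Edge : ∀ {n} → Graph n → Fin n → Fin n → Set
Edge G x y = adj G x y ≡ true

NonEdge : ∀ {n} → Graph n → Fin n → Fin n → Set
NonEdge G x y = (x ≢ y) × (adj G x y ≡ false)

-- The graph G + ab obtained by adding the pair {a,b}  (used with a ≢ b).
addAdj : ∀ {n} → (Fin n → Fin n → Bool) → Fin n → Fin n → Fin n → Fin n → Bool
addAdj f a b x y =
  f x y ∨ ((⌊ x ≟ a ⌋ ∧ ⌊ y ≟ b ⌋) ∨ (⌊ x ≟ b ⌋ ∧ ⌊ y ≟ a ⌋))

IsCliqueIn : ∀ {n} → (Fin n → Fin n → Bool) → Subset n → Set
IsCliqueIn f S = ∀ x y → x ∈ S → y ∈ S → x ≢ y → f x y ≡ true

IsKCopy : ∀ {n} → (Fin n → Fin n → Bool) → ℕ → Subset n → Set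
IsKCopy f k S = (∣ S ∣ ≡ k) × IsCliqueIn f S

StronglySat : ∀ {n} → ℕ → Graph n → Set
StronglySat {n} s G =
  ∀ a b → NonEdge G a b →
    Σ (Subset n) λ S → IsKCopy (addAdj (adj G) a b) s S × ¬ IsKCopy (adj G) s S

allSubsets : (n : ℕ) → List (Subset n)
allSubsets zero = [] ∷ []
allSubsets (suc n) = map (false ∷_) (allSubsets n) ++ map (true ∷_) (allSubsets n)

isClique? : ∀ {n} (f : Fin n → Fin n → Bool) (S : Subset n) → Dec (IsCliqueIn f S)
isClique? f S = all? λ x → all? λ y → dec x y
  where
  dec : ∀ x y → Dec (x ∈ S → y ∈ S → x ≢ y → f x y ≡ true)
  dec x y with f x y ≟B true
  ... | yes p = yes (λ _ _ _ → p)
  ... | no ¬p with x ∈? S | y ∈? S | x ≟ y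
  ...   | yes xS | yes yS | no x≢y = no (λ h → ¬p (h xS yS x≢y))
  ...   | no ¬xS | _ | _ = yes (λ xS → Data.Empty.⊥-elim (¬xS xS))
    where import Data.Empty
  ...   | yes _ | no ¬yS | _ = yes (λ _ yS → Data.Empty.⊥-elim (¬yS yS))
    where import Data.Empty
  ...   | yes _ | yes _ | yes x≡y = yes (λ _ _ x≢y → Data.Empty.⊥-elim (x≢y x≡y))
    where import Data.Empty

isKCopy? : ∀ {n} (f : Fin n → Fin n → Bool) (k : ℕ) (S : Subset n) → Dec (IsKCopy f k S)
isKCopy? f k S = (∣ S ∣ ≟ℕ k) ×-dec isClique? f S

countK : ∀ {n} → ℕ → Graph n → ℕ
countK {n} k G = length (filter (isKCopy? (adj G) k) (allSubsets n))

IsSsatExtremal : ∀ {n} → ℕ → ℕ → Graph n → Set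
IsSsatExtremal {n} r s G =
  StronglySat s G × (∀ (H : Graph n) → StronglySat s H → countK r G Data.Nat.≤ countK r H)

InE₁ : ∀ {n} → ℕ → Graph n → Fin n → Fin n → Set
InE₁ {n} r G u v = Edge G u v × Σ (Subset n) λ S → IsKCopy (adj G) r S × u ∈ S × v ∈ S

InE₂ : ∀ {n} → ℕ → Graph n → Fin n → Fin n → Set
InE₂ r G u v = Edge G u v × ¬ InE₁ r G u v

-- Let S be a copy of K_s in G + ab through the edge uv. Since uv is an edge and ab
-- is not, one of a, b — call it w — differs from u and v. Every edge of G + ab not in G contains
-- w, so S - w is a clique of G with s - 1 ≥ r vertices containing u and v; any r of its vertices
-- including u and v form a copy of K_r in G through uv, contradicting uv ∈ E₂.
module Submission where

open import Defs hiding (sym)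
open import Data.Bool using (Bool; true; false)
open import Data.Nat using (ℕ; _<_; _≤_; zero; suc; _+_; s≤s; z≤n)
open import Data.Nat.Properties
  using (≤-trans; ≤-antisym; ≰⇒>; +-suc; +-monoʳ-≤; n≤1+n; +-comm; ≤-pred; _≤?_)
open import Data.Fin using (Fin; _≟_)
open import Data.Fin.Subset
  using (Subset; inside; outside; _∈_; _∉_; _⊆_; ∣_∣; _∪_; _─_; _-_; ⁅_⁆)
open import Data.Fin.Subset.Properties
  using ( drop-∷-⊆; out⊆-⇔; in⊆in-⇔; ⊆-refl; x∈p∪q⁻; x∈p∪q⁺; x∈⁅x⁆
        ; x∈⁅y⁆⇒x≡y; ∣⁅x⁆∣≡1; p─q⊆p; x∈p∧x≢y⇒x∈p-y)
open import Data.Vec using (_∷_; []; here; there)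
open import Data.Product using (Σ; ∃; _×_; _,_)
open import Data.Sum using (_⊎_; inj₁; inj₂; [_,_])
open import Data.Empty using (⊥-elim)
open import Function using (_∘_)
open import Function.Bundles using (Equivalence)
open import Relation.Nullary using (¬_; yes; no)
open import Relation.Binary.PropositionalEquality using (_≡_; _≢_; refl; sym; trans; cong; subst; subst₂)

private
  variable
    n : ℕ

∣p∪q∣≤∣p∣+∣q∣ : (p q : Subset n) → ∣ p ∪ q ∣ ≤ ∣ p ∣ + ∣ q ∣
∣p∪q∣≤∣p∣+∣q∣ []            []            = z≤n
∣p∪q∣≤∣p∣+∣q∣ (outside ∷ p) (outside ∷ q) = ∣p∪q∣≤∣p∣+∣q∣ p q
∣p∪q∣≤∣p∣+∣q∣ (outside ∷ p) (inside  ∷ q) =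
  subst (suc ∣ p ∪ q ∣ ≤_) (sym (+-suc ∣ p ∣ ∣ q ∣)) (s≤s (∣p∪q∣≤∣p∣+∣q∣ p q))
∣p∪q∣≤∣p∣+∣q∣ (inside  ∷ p) (outside ∷ q) = s≤s (∣p∪q∣≤∣p∣+∣q∣ p q)
∣p∪q∣≤∣p∣+∣q∣ (inside  ∷ p) (inside  ∷ q) =
  s≤s (≤-trans (∣p∪q∣≤∣p∣+∣q∣ p q) (+-monoʳ-≤ ∣ p ∣ (n≤1+n ∣ q ∣)))

∣p∣≤∣p─q∣+∣q∣ : (p q : Subset n) → ∣ p ∣ ≤ ∣ p ─ q ∣ + ∣ q ∣
∣p∣≤∣p─q∣+∣q∣ []            []            = z≤n
∣p∣≤∣p─q∣+∣q∣ (outside ∷ p) (outside ∷ q) = ∣p∣≤∣p─q∣+∣q∣ p q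
∣p∣≤∣p─q∣+∣q∣ (inside  ∷ p) (outside ∷ q) = s≤s (∣p∣≤∣p─q∣+∣q∣ p q)
∣p∣≤∣p─q∣+∣q∣ (outside ∷ p) (inside  ∷ q) =
  ≤-trans (∣p∣≤∣p─q∣+∣q∣ p q) (+-monoʳ-≤ ∣ p ─ q ∣ (n≤1+n ∣ q ∣))
∣p∣≤∣p─q∣+∣q∣ (inside  ∷ p) (inside  ∷ q) =
  subst (suc ∣ p ∣ ≤_) (sym (+-suc ∣ p ─ q ∣ ∣ q ∣)) (s≤s (∣p∣≤∣p─q∣+∣q∣ p q))

x∈q⇒x∉p─q : ∀ {x : Fin n} (p q : Subset n) → x ∈ q → x ∉ p ─ q
x∈q⇒x∉p─q (_ ∷ p) (inside  ∷ q) here        ()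
x∈q⇒x∉p─q (_ ∷ p) (_       ∷ q) (there x∈q) (there x∈p─q) = x∈q⇒x∉p─q p q x∈q x∈p─q

x∉p-x : (p : Subset n) (x : Fin n) → x ∉ p - x
x∉p-x p x = x∈q⇒x∉p─q p ⁅ x ⁆ (x∈⁅x⁆ x)

∣p∣≤1+∣p-x∣ : (p : Subset n) (x : Fin n) → ∣ p ∣ ≤ suc ∣ p - x ∣
∣p∣≤1+∣p-x∣ p x = subst (∣ p ∣ ≤_) (trans (cong (∣ p - x ∣ +_) (∣⁅x⁆∣≡1 x)) (+-comm ∣ p - x ∣ 1))
  (∣p∣≤∣p─q∣+∣q∣ p ⁅ x ⁆)

⊆-between : ∀ k (p q : Subset n) → p ⊆ q → ∣ p ∣ ≤ k → k ≤ ∣ q ∣ →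
  ∃ λ t → p ⊆ t × t ⊆ q × ∣ t ∣ ≡ k
⊆-between zero [] [] _ _ _ = [] , (λ ()) , (λ ()) , refl
⊆-between k (outside ∷ p) (outside ∷ q) p⊆q p≤k k≤q
  with t , p⊆t , t⊆q , ∣t∣≡k ← ⊆-between k p q (drop-∷-⊆ p⊆q) p≤k k≤q =
  outside ∷ t , Equivalence.to out⊆-⇔ p⊆t , Equivalence.to out⊆-⇔ t⊆q , ∣t∣≡k
⊆-between k (inside ∷ p) (outside ∷ q) p⊆q _ _ with p⊆q here
... | ()
⊆-between (suc k) (inside ∷ p) (inside ∷ q) p⊆q (s≤s p≤k) (s≤s k≤q)
  with t , p⊆t , t⊆q , refl ← ⊆-between k p q (drop-∷-⊆ p⊆q) p≤k k≤q =
  inside ∷ t , Equivalence.to in⊆in-⇔ p⊆t , Equivalence.to in⊆in-⇔ t⊆q , refl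
⊆-between k (outside ∷ p) (inside ∷ q) p⊆q p≤k k≤1+q with k ≤? ∣ q ∣
... | yes k≤q with t , p⊆t , t⊆q , ∣t∣≡k ← ⊆-between k p q (drop-∷-⊆ p⊆q) p≤k k≤q =
  outside ∷ t , Equivalence.to out⊆-⇔ p⊆t , Equivalence.to out⊆-⇔ t⊆q , ∣t∣≡k
... | no k≰q = inside ∷ q , p⊆q , ⊆-refl , ≤-antisym (≰⇒> k≰q) k≤1+q

⁅x⁆∪⁅y⁆⊆p : ∀ {x y} {p : Subset n} → x ∈ p → y ∈ p → ⁅ x ⁆ ∪ ⁅ y ⁆ ⊆ p
⁅x⁆∪⁅y⁆⊆p {x = x} {y} {p} x∈p y∈p z∈xy with x∈p∪q⁻ ⁅ x ⁆ ⁅ y ⁆ z∈xy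
... | inj₁ z∈x = subst (_∈ p) (sym (x∈⁅y⁆⇒x≡y x z∈x)) x∈p
... | inj₂ z∈y = subst (_∈ p) (sym (x∈⁅y⁆⇒x≡y y z∈y)) y∈p

∣⁅x⁆∪⁅y⁆∣≤2 : (x y : Fin n) → ∣ ⁅ x ⁆ ∪ ⁅ y ⁆ ∣ ≤ 2
∣⁅x⁆∪⁅y⁆∣≤2 x y =
  subst₂ (λ i j → ∣ ⁅ x ⁆ ∪ ⁅ y ⁆ ∣ ≤ i + j) (∣⁅x⁆∣≡1 x) (∣⁅x⁆∣≡1 y) (∣p∪q∣≤∣p∣+∣q∣ ⁅ x ⁆ ⁅ y ⁆)

⊆-between-pair : ∀ k (q : Subset n) {u v} → u ∈ q → v ∈ q → 2 ≤ k → k ≤ ∣ q ∣ →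
  ∃ λ t → t ⊆ q × ∣ t ∣ ≡ k × u ∈ t × v ∈ t
⊆-between-pair k q {u} {v} u∈q v∈q 2≤k k≤q
  with t , uv⊆t , t⊆q , ∣t∣≡k
       ← ⊆-between k (⁅ u ⁆ ∪ ⁅ v ⁆) q (⁅x⁆∪⁅y⁆⊆p u∈q v∈q) (≤-trans (∣⁅x⁆∪⁅y⁆∣≤2 u v) 2≤k) k≤q =
  t , t⊆q , ∣t∣≡k , uv⊆t (x∈p∪q⁺ (inj₁ (x∈⁅x⁆ u))) , uv⊆t (x∈p∪q⁺ (inj₂ (x∈⁅x⁆ v)))

addAdj-true⁻ : (f : Fin n → Fin n → Bool) (a b x y : Fin n) → addAdj f a b x y ≡ true →
  f x y ≡ true ⊎ (x ≡ a × y ≡ b) ⊎ (x ≡ b × y ≡ a)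
addAdj-true⁻ f a b x y h with f x y | x ≟ a | y ≟ b | x ≟ b | y ≟ a
... | true  | _        | _        | _        | _        = inj₁ refl
... | false | yes x≡a  | yes y≡b  | _        | _        = inj₂ (inj₁ (x≡a , y≡b))
... | false | _        | _        | yes x≡b  | yes y≡a  = inj₂ (inj₂ (x≡b , y≡a))
addAdj-true⁻ f a b x y () | false | no _  | _     | no _  | _
addAdj-true⁻ f a b x y () | false | no _  | _     | yes _ | no _
addAdj-true⁻ f a b x y () | false | yes _ | no _  | no _  | _
addAdj-true⁻ f a b x y () | false | yes _ | no _  | yes _ | no _

IsCliqueIn-⊆ : ∀ {f : Fin n → Fin n → Bool} {p q} → p ⊆ q → IsCliqueIn f q → IsCliqueIn f p
IsCliqueIn-⊆ p⊆q q-clique x y x∈p y∈p = q-clique x y (p⊆q x∈p) (p⊆q y∈p)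

IsCliqueIn-addAdj⁻ : ∀ {f : Fin n → Fin n → Bool} {a b S} →
  a ∉ S ⊎ b ∉ S → IsCliqueIn (addAdj f a b) S → IsCliqueIn f S
IsCliqueIn-addAdj⁻ {f = f} {a} {b} a∉S⊎b∉S clique x y x∈S y∈S x≢y
  with addAdj-true⁻ f a b x y (clique x y x∈S y∈S x≢y)
... | inj₁ fxy                  = fxy
... | inj₂ (inj₁ (refl , refl)) = ⊥-elim ([ (λ a∉S → a∉S x∈S) , (λ b∉S → b∉S y∈S) ] a∉S⊎b∉S)
... | inj₂ (inj₂ (refl , refl)) = ⊥-elim ([ (λ a∉S → a∉S y∈S) , (λ b∉S → b∉S x∈S) ] a∉S⊎b∉S)

IsCliqueIn-addAdj-remove : ∀ {f : Fin n → Fin n → Bool} {a b w S} →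
  w ≡ a ⊎ w ≡ b → IsCliqueIn (addAdj f a b) S → IsCliqueIn f (S - w)
IsCliqueIn-addAdj-remove {S = S} (inj₁ refl) clique =
  IsCliqueIn-addAdj⁻ (inj₁ (x∉p-x S _)) (IsCliqueIn-⊆ (p─q⊆p S _) clique)
IsCliqueIn-addAdj-remove {S = S} (inj₂ refl) clique =
  IsCliqueIn-addAdj⁻ (inj₂ (x∉p-x S _)) (IsCliqueIn-⊆ (p─q⊆p S _) clique)

IsCliqueIn⇒IsKCopy-through : ∀ {f : Fin n → Fin n → Bool} {S u v} k →
  IsCliqueIn f S → u ∈ S → v ∈ S → 2 ≤ k → k ≤ ∣ S ∣ →
  Σ (Subset n) λ T → IsKCopy f k T × u ∈ T × v ∈ T
IsCliqueIn⇒IsKCopy-through {S = S} k clique u∈S v∈S 2≤k k≤∣S∣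
  with T , T⊆S , ∣T∣≡k , u∈T , v∈T ← ⊆-between-pair k S u∈S v∈S 2≤k k≤∣S∣ =
  T , (∣T∣≡k , IsCliqueIn-⊆ T⊆S clique) , u∈T , v∈T

Edge⇒adj≢false : (G : Graph n) {x y : Fin n} → Edge G x y → adj G x y ≢ false
Edge⇒adj≢false G xy xy≡false with trans (sym xy) xy≡false
... | ()

nonEdge-endpoint-off-edge : (G : Graph n) {u v a b : Fin n} → Edge G u v → NonEdge G a b →
  ∃ λ w → (w ≡ a ⊎ w ≡ b) × w ≢ u × w ≢ v
nonEdge-endpoint-off-edge G {u} {v} {a} {b} uv (a≢b , ab) with a ≟ u | a ≟ v
... | no a≢u   | no a≢v = a , inj₁ refl , a≢u , a≢v
... | yes refl | _      = b , inj₂ refl , a≢b ∘ sym , λ { refl → Edge⇒adj≢false G uv ab }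
... | no _     | yes refl =
  b , inj₂ refl , (λ { refl → Edge⇒adj≢false G uv (trans (Graph.sym G u a) ab) }) , a≢b ∘ sym

lemma2p1 : (r s n : ℕ) → 2 ≤ r → r < s → (G : Graph n) → IsSsatExtremal r s G →
    (u v : Fin n) → InE₂ r G u v → (a b : Fin n) → NonEdge G a b →
    ¬ (Σ (Subset n) λ S → IsKCopy (addAdj (adj G) a b) s S × u ∈ S × v ∈ S)
lemma2p1 r s n 2≤r r<s G _ u v (uv , uv∉E₁) a b ab (S , (∣S∣≡s , S-clique) , u∈S , v∈S) =
  uv∉E₁ (uv , Kr-through-uv (nonEdge-endpoint-off-edge G uv ab))
  where
  Kr-through-uv : (∃ λ w → (w ≡ a ⊎ w ≡ b) × w ≢ u × w ≢ v) →
    Σ (Subset n) λ T → IsKCopy (adj G) r T × u ∈ T × v ∈ T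
  Kr-through-uv (w , w∈ab , w≢u , w≢v) =
    IsCliqueIn⇒IsKCopy-through r (IsCliqueIn-addAdj-remove w∈ab S-clique)
      (x∈p∧x≢y⇒x∈p-y u∈S (w≢u ∘ sym)) (x∈p∧x≢y⇒x∈p-y v∈S (w≢v ∘ sym)) 2≤r r≤∣S-w∣
    where
    r≤∣S-w∣ : r ≤ ∣ S - w ∣
    r≤∣S-w∣ = ≤-pred (≤-trans r<s (subst (_≤ suc ∣ S - w ∣) ∣S∣≡s (∣p∣≤1+∣p-x∣ S w)))
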